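{- Let $\mathbf{m}$ be the Thue–Morse word. If $k\ge1$ and $n\le 2^k$, then $\operatorname{nsc}_{\mathbf{m}}(n)\le 3\cdot 2^{k-1}$.
   Context: The Thue–Morse word is $\mathbf{m}=\mu^{\omega}(0)$, the fixed point starting with $0$ of the morphism $\mu(0)=01$, $\mu(1)=10$. For an infinite word $\mathbf{x}=x_0x_1x_2\cdots$ (indexed from $0$) and $n\ge1$, $\operatorname{nsc}_{\mathbf{x}}(n)=\max\{m\in\mathbb{N}: x_i\cdots x_{i+n-1}\neq x_j\cdots x_{j+n-1}\text{ for all } 0\le i<j\le m-1\}$. -}

module Defs where

open import Data.Nat using (ℕ; zero; suc; _+_; _<_; _≤_)
open import Data.Bool using (Bool; true; false; not)
open import Data.List using (List; []; _∷_; concatMap)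
open import Relation.Binary.PropositionalEquality using (_≡_)
open import Relation.Nullary using (¬_)

-- Binary alphabet {0,1}: false = 0, true = 1.

μ : Bool → List Bool
μ b = b ∷ not b ∷ []

μ* : List Bool → List Bool
μ* = concatMap μ

μpow : ℕ → List Bool
μpow zero    = false ∷ []
μpow (suc n) = μ* (μpow n)

-- Total indexing into a finite word (default 0 out of range; never used
-- out of range below since |μ^(i+1)(0)| = 2^(i+1) > i).
at : List Bool → ℕ → Bool
at []      _       = false
at (b ∷ w) zero    = b
at (b ∷ w) (suc i) = at w i

-- The Thue–Morse word m = μ^ω(0), as a function ℕ → {0,1}:
-- its i-th letter (0-indexed) is the i-th letter of the prefix μ^(i+1)(0).
tm : ℕ → Bool
tm i = at (μpow (suc i)) i

Word : Set
Word = ℕ → Bool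

SameFactor : Word → ℕ → ℕ → ℕ → Set
SameFactor x n i j = ∀ t → t < n → x (i + t) ≡ x (j + t)

DistinctPrefixFactors : Word → ℕ → ℕ → Set
DistinctPrefixFactors x n m = ∀ i j → i < j → j < m → ¬ SameFactor x n i j

-- nsc_x(n) ≤ B  ⇔  every m in the set defining nsc_x(n) satisfies m ≤ B.
NscLe : Word → ℕ → ℕ → Set
NscLe x n B = ∀ m → DistinctPrefixFactors x n m → m ≤ B

-- Idea: the factors of length 2^k at positions 0 and 3·2^(k-1) coincide,
-- so at most 3·2^(k-1) leading factors of length n ≤ 2^k can be pairwise
-- distinct.  The coincidence is proved by induction on k from the two
-- recurrences m(2i) = m(i), m(2i+1) = ¬m(i): applying μ to two equal
-- factors of length L at positions a and 0 gives equal factors of length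
-- 2L at positions 2a and 0; the base case is m(3)m(4) = 01 = m(0)m(1).
module Submission where

open import Defs
open import Data.Nat using (ℕ; _≤_; _*_; _^_; _∸_)
open import Data.Nat using (zero; suc; _+_; _<_; z≤n; s≤s; _≤?_)
open import Data.Nat.Properties
open import Data.Bool using (true; not)
open import Data.List using ([]; _∷_; _++_; length)
open import Data.List.Properties using (++-assoc; ++-identityʳ; concatMap-++)
open import Data.Product using (∃; _,_)
open import Data.Sum using (inj₁; inj₂)
open import Data.Empty using (⊥-elim)
open import Relation.Binary.PropositionalEquality
open import Relation.Nullary using (yes; no)
open import Algebra.Properties.CommutativeSemigroup +-commutativeSemigroup
  using (interchange)

data Parity : ℕ → Set where
  even : ∀ q → Parity (q + q)
  odd  : ∀ q → Parity (suc (q + q))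

parity : ∀ t → Parity t
parity zero = even zero
parity (suc t) with parity t
... | even q = odd q
... | odd q  = subst Parity (cong suc (+-suc q q)) (even (suc q))

2^suc : ∀ n → 2 ^ suc n ≡ 2 ^ n + 2 ^ n
2^suc n = cong (2 ^ n +_) (+-identityʳ (2 ^ n))

halve-< : ∀ {q X} → q + q < X + X → q < X
halve-< p = ≰⇒> (λ X≤q → <⇒≱ p (+-mono-≤ X≤q X≤q))

double-< : ∀ {q X} → q < X → suc (q + q) < X + X
double-< {q} {X} p = subst (λ s → suc s ≤ X + X) (+-suc q q) (+-mono-≤ p p)

n<2^n : ∀ n → n < 2 ^ n
n<2^n zero    = s≤s z≤n
n<2^n (suc n) = subst (suc (suc n) ≤_) (sym (2^suc n)) (+-mono-≤ (m^n>0 2 n) (n<2^n n))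

n<2^suc-n : ∀ n → n < 2 ^ suc n
n<2^suc-n n = <-trans (n<2^n n) (^-monoʳ-< 2 (s≤s (s≤s z≤n)) (n<1+n n))

length-μ* : ∀ w → length (μ* w) ≡ length w + length w
length-μ* []      = refl
length-μ* (b ∷ w) = cong suc (trans (cong suc (length-μ* w)) (sym (+-suc (length w) (length w))))

length-μpow : ∀ n → length (μpow n) ≡ 2 ^ n
length-μpow zero    = refl
length-μpow (suc n) = begin
  length (μ* (μpow n))              ≡⟨ length-μ* (μpow n) ⟩
  length (μpow n) + length (μpow n) ≡⟨ cong (λ l → l + l) (length-μpow n) ⟩
  2 ^ n + 2 ^ n                     ≡⟨ sym (2^suc n) ⟩
  2 ^ suc n                         ∎
  where open ≡-Reasoning

at-μ*-even : ∀ w i → at (μ* w) (i + i) ≡ at w i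
at-μ*-even []      i       = refl
at-μ*-even (b ∷ w) zero    = refl
at-μ*-even (b ∷ w) (suc i) rewrite +-suc i i = at-μ*-even w i

at-μ*-odd : ∀ w i → i < length w → at (μ* w) (suc (i + i)) ≡ not (at w i)
at-μ*-odd (b ∷ w) zero    _       = refl
at-μ*-odd (b ∷ w) (suc i) (s≤s p) rewrite +-suc i i = at-μ*-odd w i p

at-++ˡ : ∀ w v i → i < length w → at (w ++ v) i ≡ at w i
at-++ˡ (b ∷ w) v zero    _       = refl
at-++ˡ (b ∷ w) v (suc i) (s≤s p) = at-++ˡ w v i p

-- μ(0) = 0·1 extends 0, and applying μ preserves the prefix relation.
μpow-step : ∀ n → ∃ λ x → μpow (suc n) ≡ μpow n ++ x
μpow-step zero = true ∷ [] , refl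
μpow-step (suc n) with μpow-step n
... | x , eq = μ* x , trans (cong μ* eq) (concatMap-++ μ (μpow n) x)

μpow-prefix : ∀ M d → ∃ λ x → μpow (d + M) ≡ μpow M ++ x
μpow-prefix M zero = [] , sym (++-identityʳ (μpow M))
μpow-prefix M (suc d) with μpow-prefix M d | μpow-step (d + M)
... | x , eq | y , eq′ = x ++ y , (begin
  μpow (suc (d + M))     ≡⟨ eq′ ⟩
  μpow (d + M) ++ y      ≡⟨ cong (_++ y) eq ⟩
  (μpow M ++ x) ++ y     ≡⟨ ++-assoc (μpow M) x y ⟩
  μpow M ++ (x ++ y)     ∎)
  where open ≡-Reasoning

at-μpow-stable : ∀ M N i → M ≤ N → i < 2 ^ M → at (μpow N) i ≡ at (μpow M) i
at-μpow-stable M N i M≤N i<2^M with μpow-prefix M (N ∸ M)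
... | x , eq = begin
  at (μpow N) i             ≡⟨ cong (λ K → at (μpow K) i) (sym (m∸n+n≡m M≤N)) ⟩
  at (μpow (N ∸ M + M)) i   ≡⟨ cong (λ w → at w i) eq ⟩
  at (μpow M ++ x) i        ≡⟨ at-++ˡ (μpow M) x i (subst (i <_) (sym (length-μpow M)) i<2^M) ⟩
  at (μpow M) i             ∎
  where open ≡-Reasoning

tm-at : ∀ N i → i < 2 ^ N → tm i ≡ at (μpow N) i
tm-at N i i<2^N with ≤-total (suc i) N
... | inj₁ le = sym (at-μpow-stable (suc i) N i le (n<2^suc-n i))
... | inj₂ le = at-μpow-stable N (suc i) i le i<2^N

tm-even : ∀ i → tm (i + i) ≡ tm i
tm-even i = begin
  tm (i + i)                            ≡⟨ tm-at (suc (suc i)) (i + i) bound ⟩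
  at (μ* (μpow (suc i))) (i + i)        ≡⟨ at-μ*-even (μpow (suc i)) i ⟩
  at (μpow (suc i)) i                   ∎
  where
    open ≡-Reasoning
    bound : i + i < 2 ^ suc (suc i)
    bound = subst (i + i <_) (sym (2^suc (suc i))) (+-mono-< (n<2^suc-n i) (n<2^suc-n i))

tm-odd : ∀ i → tm (suc (i + i)) ≡ not (tm i)
tm-odd i = begin
  tm (suc (i + i))                      ≡⟨ tm-at (suc (suc i)) (suc (i + i)) bound ⟩
  at (μ* (μpow (suc i))) (suc (i + i))  ≡⟨ at-μ*-odd (μpow (suc i)) i inside ⟩
  not (at (μpow (suc i)) i)             ∎
  where
    open ≡-Reasoning
    bound : suc (i + i) < 2 ^ suc (suc i)
    bound = subst (suc (i + i) <_) (sym (2^suc (suc i))) (double-< (n<2^suc-n i))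
    inside : i < length (μpow (suc i))
    inside = subst (i <_) (sym (length-μpow (suc i))) (n<2^suc-n i)

-- If the length-L factors at positions a and 0 agree, then so do the
-- length-2L factors at positions 2a and 0 (their images under μ).
factor-doubling : ∀ a L → SameFactor tm L a 0 → SameFactor tm (L + L) (a + a) 0
factor-doubling a L same t t<2L with parity t
... | even q = begin
  tm (a + a + (q + q))         ≡⟨ cong tm (interchange a a q q) ⟩
  tm ((a + q) + (a + q))       ≡⟨ tm-even (a + q) ⟩
  tm (a + q)                   ≡⟨ same q (halve-< t<2L) ⟩
  tm q                         ≡⟨ sym (tm-even q) ⟩
  tm (q + q)                   ∎
  where open ≡-Reasoning
... | odd q = begin
  tm (a + a + suc (q + q))     ≡⟨ cong tm (trans (+-suc (a + a) (q + q)) (cong suc (interchange a a q q))) ⟩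
  tm (suc ((a + q) + (a + q))) ≡⟨ tm-odd (a + q) ⟩
  not (tm (a + q))             ≡⟨ cong not (same q (halve-< (<-trans (n<1+n _) t<2L))) ⟩
  not (tm q)                   ≡⟨ sym (tm-odd q) ⟩
  tm (suc (q + q))             ∎
  where open ≡-Reasoning

period : ∀ j → SameFactor tm (2 ^ suc j) (3 * 2 ^ j) 0
period zero    zero          _ = refl
period zero    (suc zero)    _ = refl
period zero    (suc (suc t)) (s≤s (s≤s ()))
period (suc j) =
  subst₂ (λ L a → SameFactor tm L a 0) (sym (2^suc (suc j))) (sym 3·2^suc)
    (factor-doubling (3 * 2 ^ j) (2 ^ suc j) (period j))
  where
    3·2^suc : 3 * 2 ^ suc j ≡ 3 * 2 ^ j + 3 * 2 ^ j
    3·2^suc = trans (cong (3 *_) (2^suc j)) (*-distribˡ-+ 3 (2 ^ j) (2 ^ j))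

repeat-bounds-nsc : ∀ x n i j → i < j → SameFactor x n i j → NscLe x n j
repeat-bounds-nsc x n i j i<j same m distinct with m ≤? j
... | yes m≤j = m≤j
... | no  m≰j = ⊥-elim (distinct i j i<j (≰⇒> m≰j) same)

mainTheorem7 : ∀ k n → 1 ≤ k → 1 ≤ n → n ≤ 2 ^ k → NscLe tm n (3 * 2 ^ (k ∸ 1))
mainTheorem7 (suc j) n _ _ n≤2^k =
  repeat-bounds-nsc tm n 0 (3 * 2 ^ j) (*-monoʳ-< 3 (m^n>0 2 j))
    (λ t t<n → sym (period j t (<-≤-trans t<n n≤2^k)))
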